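{- Let $q$ be a prime power and $m$ a positive integer. For any integers $i,j$ with $1\leq i<j\leq m+2$, the girth of the jumped Wenger graph $J_m(q,i,j)$ is less than or equal to $8$.
   Context: Jumped Wenger graph: for a prime power $q$, a positive integer $m$ and integers $1\le i<j\le m+2$, let $(f_1(x),\dots,f_{m+1}(x))$ be the list of monomials $x^k$, $k\in\{0,1,\dots,m+2\}\setminus\{i,j\}$, in increasing order of exponent (so $f_1=1$). $J_m(q,i,j)$ is the bipartite graph whose vertex set is the disjoint union of the point set $\mathbb{F}_q^{m+1}$ (points $P=(p_1,\dots,p_{m+1})$) and the line set $\mathbb{F}_q^{m+1}$ (lines $L=[l_1,\dots,l_{m+1}]$), where $P$ is adjacent to $L$ iff $l_k+p_k=l_1 f_k(p_1)$ for all $k=2,\dots,m+1$. The girth is the length of a shortest cycle in the graph. -}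

module Defs where

open import Level using (0ℓ)
open import Data.Nat using (ℕ; zero; suc; _≤_; _<_; _≟_)
open import Data.Fin using (Fin; toℕ; inject₁; fromℕ) renaming (zero to fzero; suc to fsuc)
open import Data.List using (List; filter; upTo)
open import Data.List.Base using (lookup)
open import Data.Product using (Σ; ∃; _×_; _,_)
open import Data.Sum using (_⊎_; inj₁; inj₂)
open import Data.Empty using (⊥)
open import Relation.Nullary using (¬_; ¬?)
open import Relation.Nullary.Decidable using (_×-dec_)
open import Relation.Binary.PropositionalEquality using (_≡_)
open import Algebra.Bundles using (CommutativeRing)

record FiniteField : Set₁ where
  field
    commRing : CommutativeRing 0ℓ 0ℓ
  open CommutativeRing commRing public
  field
    0≉1     : ¬ (0# ≈ 1#)
    inverse : ∀ x → ¬ (x ≈ 0#) → ∃ λ y → (x * y) ≈ 1#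
    size    : ℕ
    enum    : Fin size → Carrier
    enum-onto : ∀ x → ∃ λ k → enum k ≈ x

module _ {V : Set} (_≈V_ : V → V → Set) (Adj : V → V → Set) where

  record Cycle (n' : ℕ) : Set where
    field
      vtx      : Fin (suc n') → V
      distinct : ∀ a b → vtx a ≈V vtx b → a ≡ b
      step     : ∀ (a : Fin n') → Adj (vtx (inject₁ a)) (vtx (fsuc a))
      close    : Adj (vtx (fromℕ n')) (vtx fzero)

  GirthAtMost : ℕ → Set
  GirthAtMost g = ∃ λ n' → (3 ≤ suc n') × (suc n' ≤ g) × Cycle n'

module Jumped (F : FiniteField) (m i j : ℕ) where
  open FiniteField F

  pow : Carrier → ℕ → Carrier
  pow x zero    = 1#
  pow x (suc n) = x * pow x n

  exps : List ℕ
  exps = filter (λ k → ¬? (k ≟ i) ×-dec ¬? (k ≟ j)) (upTo (suc (suc (suc m))))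

  -- exponent of f_{t+1} (0-based index t); default 0 never used when
  -- 1 ≤ i < j ≤ m+2 (then exps has length m+1)
  expo : ℕ → ℕ
  expo t = nth exps t
    where
      nth : List ℕ → ℕ → ℕ
      nth List.[] _ = 0
      nth (x List.∷ xs) zero = x
      nth (x List.∷ xs) (suc t) = nth xs t

  -- points and lines: F^{m+1}; index 0 is the first coordinate
  Point : Set
  Point = Fin (suc m) → Carrier

  Line : Set
  Line = Fin (suc m) → Carrier

  Incident : Point → Line → Set
  Incident P L = ∀ (k : Fin (suc m)) → 1 ≤ toℕ k →
    (L k + P k) ≈ (L fzero * pow (P fzero) (expo (toℕ k)))

  Vertex : Set
  Vertex = Point ⊎ Line

  _≈V_ : Vertex → Vertex → Set
  inj₁ P ≈V inj₁ P' = ∀ k → P k ≈ P' k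
  inj₂ L ≈V inj₂ L' = ∀ k → L k ≈ L' k
  _ ≈V _ = ⊥

  Adj : Vertex → Vertex → Set
  Adj (inj₁ P) (inj₂ L) = Incident P L
  Adj (inj₂ L) (inj₁ P) = Incident P L
  Adj _ _ = ⊥

  GirthAtMostJ : ℕ → Set
  GirthAtMostJ g = GirthAtMost _≈V_ Adj g

-- Write a and b for the vectors of values at 0 and at 1 of the monomials f₂, …, f_{m+1}, so b = 1.
-- The points (0,0), (1,0), (0,a-b), (1,b-a) and the lines [0,0], [1,b], [2,a+b], [1,a] (first
-- coordinate, then the rest) form the closed walk P₀L₀P₁L₁P₂L₂P₃L₃, and it is a genuine 8-cycle as
-- soon as some coordinate has aₖ ≠ bₖ and aₖ + bₖ ≠ 0.  Since i ≥ 1, the monomial f₂ has positive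
-- exponent, so its coordinate has a = 0 and b = 1.
module Submission where

open import Defs
open import Algebra.Bundles using (CommutativeRing)
import Algebra.Properties.Group as GroupProperties
open import Data.Nat using (ℕ; zero; suc; _≤_; _<_; z≤n; s≤s)
open import Data.Nat.Properties using (≤-refl)
open import Data.Fin using (Fin; toℕ; inject₁; remQuot) renaming (suc to fsuc)
open import Data.Fin.Patterns using (0F; 1F; 2F; 3F; 4F; 5F; 6F; 7F)
open import Data.Fin.Properties using (*↔×)
open import Data.Vec.Functional using (_∷_)
open import Data.Product using (_×_; _,_)
open import Data.Sum using (inj₁; inj₂)
open import Data.Empty using (⊥-elim)
open import Function using (_∘_; const; Injection)
open import Function.Properties.Inverse using (↔⇒↣)
open import Relation.Nullary using (¬_)
import Relation.Binary.PropositionalEquality as ≡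
open ≡ using (_≡_)

module CommutativeRingIdentities {c ℓ} (R : CommutativeRing c ℓ) where
  open CommutativeRing R
  open import Relation.Binary.Reasoning.Setoid setoid
  open GroupProperties +-group using (x∙y⁻¹≈ε⇒x≈y)

  x+[y-x]≈y : ∀ x y → x + (y - x) ≈ y
  x+[y-x]≈y x y = begin
    x + (y - x)   ≈⟨ +-congˡ (+-comm y (- x)) ⟩
    x + (- x + y) ≈⟨ +-assoc x (- x) y ⟨
    (x - x) + y   ≈⟨ +-congʳ (-‿inverseʳ x) ⟩
    0# + y        ≈⟨ +-identityˡ y ⟩
    y             ∎

  [1+1]*x≈x+x : ∀ x → (1# + 1#) * x ≈ x + x
  [1+1]*x≈x+x x = trans (distribʳ x 1# 1#) (+-cong (*-identityˡ x) (*-identityˡ x))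

  0+0≈0*x : ∀ x → 0# + 0# ≈ 0# * x
  0+0≈0*x x = trans (+-identityˡ 0#) (sym (zeroˡ x))

  x+0≈1*x : ∀ x → x + 0# ≈ 1# * x
  x+0≈1*x x = trans (+-identityʳ x) (sym (*-identityˡ x))

  y+[x-y]≈1*x : ∀ x y → y + (x - y) ≈ 1# * x
  y+[x-y]≈1*x x y = trans (x+[y-x]≈y y x) (sym (*-identityˡ x))

  [x+y]+[x-y]≈[1+1]*x : ∀ x y → (x + y) + (x - y) ≈ (1# + 1#) * x
  [x+y]+[x-y]≈[1+1]*x x y = begin
    (x + y) + (x - y) ≈⟨ +-assoc x y (x - y) ⟩
    x + (y + (x - y)) ≈⟨ +-congˡ (x+[y-x]≈y y x) ⟩
    x + x             ≈⟨ [1+1]*x≈x+x x ⟨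
    (1# + 1#) * x     ∎

  [x+y]+[y-x]≈[1+1]*y : ∀ x y → (x + y) + (y - x) ≈ (1# + 1#) * y
  [x+y]+[y-x]≈[1+1]*y x y = trans (+-congʳ (+-comm x y)) ([x+y]+[x-y]≈[1+1]*x y x)

  0≈x-y⇒x≈y : ∀ {x y} → 0# ≈ x - y → x ≈ y
  0≈x-y⇒x≈y {x} {y} eq = x∙y⁻¹≈ε⇒x≈y x y (sym eq)

module EightCycle (F : FiniteField) (m i j : ℕ) where
  open FiniteField F
  open Jumped F m i j
  open CommutativeRingIdentities commRing
  open GroupProperties +-group using (identityʳ-unique)

  exponent : Fin m → ℕ
  exponent k = expo (suc (toℕ k))

  at0 at1 : Fin m → Carrier
  at0 k = pow 0# (exponent k)
  at1 k = pow 1# (exponent k)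

  incident : ∀ {x y} {p l : Fin m → Carrier} →
             (∀ k → l k + p k ≈ y * pow x (exponent k)) → Incident (x ∷ p) (y ∷ l)
  incident eq 0F ()
  incident eq (fsuc k) _ = eq k

  point line : Fin 4 → Point
  point 0F = 0# ∷ const 0#
  point 1F = 1# ∷ const 0#
  point 2F = 0# ∷ λ k → at0 k - at1 k
  point 3F = 1# ∷ λ k → at1 k - at0 k
  line 0F = 0# ∷ const 0#
  line 1F = 1# ∷ at1
  line 2F = (1# + 1#) ∷ λ k → at0 k + at1 k
  line 3F = 1# ∷ at0

  vertex : Fin 4 × Fin 2 → Vertex
  vertex (t , 0F) = inj₁ (point t)
  vertex (t , 1F) = inj₂ (line t)

  -- walk (2t + s) = vertex (t , s), that is, P₀ L₀ P₁ L₁ P₂ L₂ P₃ L₃.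
  walk : Fin 8 → Vertex
  walk = vertex ∘ remQuot {4} 2

  walk-step : ∀ (s : Fin 7) → Adj (walk (inject₁ s)) (walk (fsuc s))
  walk-step 0F = incident λ k → 0+0≈0*x (at0 k)
  walk-step 1F = incident λ k → 0+0≈0*x (at1 k)
  walk-step 2F = incident λ k → x+0≈1*x (at1 k)
  walk-step 3F = incident λ k → y+[x-y]≈1*x (at0 k) (at1 k)
  walk-step 4F = incident λ k → [x+y]+[x-y]≈[1+1]*x (at0 k) (at1 k)
  walk-step 5F = incident λ k → [x+y]+[y-x]≈[1+1]*y (at0 k) (at1 k)
  walk-step 6F = incident λ k → y+[x-y]≈1*x (at1 k) (at0 k)

  walk-close : Adj (walk 7F) (walk 0F)
  walk-close = incident λ k → x+0≈1*x (at0 k)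

  1≉1+1 : ¬ 1# ≈ 1# + 1#
  1≉1+1 eq = 0≉1 (sym (identityʳ-unique 1# 1# (sym eq)))

  module _ (k : Fin m) (at0≉at1 : ¬ at0 k ≈ at1 k) (at0+at1≉0 : ¬ at0 k + at1 k ≈ 0#) where

    point-injective : ∀ s t → (∀ n → point s n ≈ point t n) → s ≡ t
    point-injective 0F 0F _ = ≡.refl
    point-injective 0F 1F eq = ⊥-elim (0≉1 (eq 0F))
    point-injective 0F 2F eq = ⊥-elim (at0≉at1 (0≈x-y⇒x≈y (eq (fsuc k))))
    point-injective 0F 3F eq = ⊥-elim (0≉1 (eq 0F))
    point-injective 1F 0F eq = ⊥-elim (0≉1 (sym (eq 0F)))
    point-injective 1F 1F _ = ≡.refl
    point-injective 1F 2F eq = ⊥-elim (0≉1 (sym (eq 0F)))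
    point-injective 1F 3F eq = ⊥-elim (at0≉at1 (sym (0≈x-y⇒x≈y (eq (fsuc k)))))
    point-injective 2F 0F eq = ⊥-elim (at0≉at1 (0≈x-y⇒x≈y (sym (eq (fsuc k)))))
    point-injective 2F 1F eq = ⊥-elim (0≉1 (eq 0F))
    point-injective 2F 2F _ = ≡.refl
    point-injective 2F 3F eq = ⊥-elim (0≉1 (eq 0F))
    point-injective 3F 0F eq = ⊥-elim (0≉1 (sym (eq 0F)))
    point-injective 3F 1F eq = ⊥-elim (at0≉at1 (sym (0≈x-y⇒x≈y (sym (eq (fsuc k))))))
    point-injective 3F 2F eq = ⊥-elim (0≉1 (sym (eq 0F)))
    point-injective 3F 3F _ = ≡.refl

    line-injective : ∀ s t → (∀ n → line s n ≈ line t n) → s ≡ t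
    line-injective 0F 0F _ = ≡.refl
    line-injective 0F 1F eq = ⊥-elim (0≉1 (eq 0F))
    line-injective 0F 2F eq = ⊥-elim (at0+at1≉0 (sym (eq (fsuc k))))
    line-injective 0F 3F eq = ⊥-elim (0≉1 (eq 0F))
    line-injective 1F 0F eq = ⊥-elim (0≉1 (sym (eq 0F)))
    line-injective 1F 1F _ = ≡.refl
    line-injective 1F 2F eq = ⊥-elim (1≉1+1 (eq 0F))
    line-injective 1F 3F eq = ⊥-elim (at0≉at1 (sym (eq (fsuc k))))
    line-injective 2F 0F eq = ⊥-elim (at0+at1≉0 (eq (fsuc k)))
    line-injective 2F 1F eq = ⊥-elim (1≉1+1 (sym (eq 0F)))
    line-injective 2F 2F _ = ≡.refl
    line-injective 2F 3F eq = ⊥-elim (1≉1+1 (sym (eq 0F)))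
    line-injective 3F 0F eq = ⊥-elim (0≉1 (sym (eq 0F)))
    line-injective 3F 1F eq = ⊥-elim (at0≉at1 (eq (fsuc k)))
    line-injective 3F 2F eq = ⊥-elim (1≉1+1 (eq 0F))
    line-injective 3F 3F _ = ≡.refl

    vertex-injective : ∀ u v → vertex u ≈V vertex v → u ≡ v
    vertex-injective (s , 0F) (t , 0F) eq = ≡.cong (_, 0F) (point-injective s t eq)
    vertex-injective (s , 1F) (t , 1F) eq = ≡.cong (_, 1F) (line-injective s t eq)
    vertex-injective (s , 0F) (t , 1F) ()
    vertex-injective (s , 1F) (t , 0F) ()

    eight-cycle : Cycle _≈V_ Adj 7
    eight-cycle = record
      { vtx      = walk
      ; distinct = λ u v → Injection.injective (↔⇒↣ *↔×) ∘ vertex-injective _ _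
      ; step     = walk-step
      ; close    = walk-close
      }

  pow-0# : ∀ n → 0 < n → pow 0# n ≈ 0#
  pow-0# (suc n) _ = zeroˡ (pow 0# n)

  pow-1# : ∀ n → pow 1# n ≈ 1#
  pow-1# zero    = refl
  pow-1# (suc n) = trans (*-identityˡ (pow 1# n)) (pow-1# n)

  positive-exponent⇒eight-cycle : (k : Fin m) → 0 < exponent k → Cycle _≈V_ Adj 7
  positive-exponent⇒eight-cycle k 0<e = eight-cycle k at0≉at1 at0+at1≉0
    where
    at0≈0 : at0 k ≈ 0#
    at0≈0 = pow-0# (exponent k) 0<e

    at1≈1 : at1 k ≈ 1#
    at1≈1 = pow-1# (exponent k)

    at0≉at1 : ¬ at0 k ≈ at1 k
    at0≉at1 eq = 0≉1 (trans (sym at0≈0) (trans eq at1≈1))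

    at0+at1≉0 : ¬ at0 k + at1 k ≈ 0#
    at0+at1≉0 eq = 0≉1 (trans (sym eq) (trans (+-cong at0≈0 at1≈1) (+-identityˡ 1#)))

-- f₂ is x³, x² or x according as {i , j} = {1 , 2}, i = 1 < 2 < j, or 2 ≤ i.
second-exponent-positive : ∀ F m i j → 1 ≤ i → i < j → 0 < Jumped.expo F (suc m) i j 1
second-exponent-positive F m 1 2 (s≤s z≤n) (s≤s (s≤s z≤n)) = s≤s z≤n
second-exponent-positive F m 1 (suc (suc (suc j))) (s≤s z≤n) (s≤s (s≤s z≤n)) = s≤s z≤n
second-exponent-positive F m (suc (suc i)) (suc (suc j)) (s≤s z≤n) (s≤s (s≤s _)) = s≤s z≤n

-- Imported only now: inside the modules above it would clash with the ring's _+_.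
open import Data.Nat using (_+_)

theorem3 : (F : FiniteField) (m i j : ℕ) → 1 ≤ m → 1 ≤ i → i < j → j ≤ m + 2 →
    Jumped.GirthAtMostJ F m i j 8
theorem3 F (suc m) i j (s≤s z≤n) 1≤i i<j _ =
  7 , s≤s (s≤s (s≤s z≤n)) , ≤-refl ,
  EightCycle.positive-exponent⇒eight-cycle F (suc m) i j 0F
    (second-exponent-positive F m i j 1≤i i<j)
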